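{- Every even binary linear code of length $n\le 46$, dimension $5$ and minimum Hamming distance $22$ contains a codeword of Hamming weight $24$.
   Context: A binary linear code of length $n$ and dimension $k$ is a $k$-dimensional subspace of $\mathbb{F}_2^n$; its minimum Hamming distance is the minimum Hamming weight of a nonzero codeword. A code is even if all its codewords have even Hamming weight. -}

module Defs where

open import Data.Bool using (Bool; true; false; _xor_; _∧_; if_then_else_)
open import Data.Nat using (ℕ; zero; suc; _+_; _≤_)
open import Data.Nat.Divisibility using (_∣_)
open import Data.Vec using (Vec; []; _∷_; replicate; zipWith; map; count)
open import Data.Product using (Σ; ∃; _×_; _,_)
open import Relation.Binary.PropositionalEquality using (_≡_)
open import Relation.Nullary using (¬_)
open import Data.Bool.Properties using (T?)

-- Vectors of F₂ⁿ, with F₂ = Bool (false = 0, true = 1, xor = addition, ∧ = multiplication)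
Word : ℕ → Set
Word n = Vec Bool n

zeroW : (n : ℕ) → Word n
zeroW n = replicate n false

_⊕_ : ∀ {n} → Word n → Word n → Word n
_⊕_ = zipWith _xor_

_·_ : ∀ {n} → Bool → Word n → Word n
b · v = map (b ∧_) v

weight : ∀ {n} → Word n → ℕ
weight = count T?

lincomb : ∀ {n k} → Vec Bool k → Vec (Word n) k → Word n
lincomb {n} []       []       = zeroW n
lincomb     (c ∷ cs) (g ∷ gs) = (c · g) ⊕ lincomb cs gs

LinIndep : ∀ {n k} → Vec (Word n) k → Set
LinIndep {n} {k} G = ∀ (c : Vec Bool k) → lincomb c G ≡ zeroW n → c ≡ zeroW k

record LinearCode (n k : ℕ) : Set where
  field
    gen   : Vec (Word n) k
    indep : LinIndep gen

open LinearCode public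

_∈C_ : ∀ {n k} → Word n → LinearCode n k → Set
_∈C_ {n} {k} w C = ∃ λ (c : Vec Bool k) → lincomb c (gen C) ≡ w

IsEven : ∀ {n k} → LinearCode n k → Set
IsEven {n} C = ∀ w → w ∈C C → 2 ∣ weight w

-- Minimum distance = minimum weight of a nonzero codeword
MinDist : ∀ {n k} → LinearCode n k → ℕ → Set
MinDist {n} C d =
  (∀ w → w ∈C C → ¬ (w ≡ zeroW n) → d ≤ weight w)
  × (∃ λ w → w ∈C C × ¬ (w ≡ zeroW n) × weight w ≡ d)

module Submission where

-- Suppose the even [n ≤ 46, 5, 22] code C had no word of weight 24.
-- Then every nonzero codeword has weight 2K with K ≥ 11 and K ≠ 12; call its
-- message v *marked* when K is even, so a marked word weighs at least 28.
--
-- 1. Span weight identity: the 2^k words Σ cᵢgᵢ (c ∈ 𝔽₂ᵏ) spanned by g₁ … g_k have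
--    total weight 2^(k−1)·s, where s is the size of the common support.
-- 2. Applied to the subcodes spanned by 3, 4 and 5 independent messages, this gives
--    for the marking: every plane of PG(4,2) carries an odd number of marked points
--    (Σ K = 2s is even), every hyperplane at most 6 (Σ K = 4s ≤ 184) and the whole
--    space at most 9 (Σ K = 8s ≤ 368).
-- 3. No marking of the 31 points of PG(4,2) has these three properties; this is
--    established by a certified backtracking search, whose soundness is proved here.

open import Defs
open import Algebra.Bundles using (CommutativeRing)
open import Data.Bool using (Bool; true; false; not; _∧_; _∨_; _xor_; if_then_else_; T)
open import Data.Bool.ListAction using (all; or)
open import Data.Bool.Properties
  using (xor-∧-commutativeRing; xor-same; not-distribˡ-xor; ∧-distribʳ-xor;
         not-involutive; not-injective; T-≡; T-∧; T-∨)
  renaming (_≟_ to _≟ᵇ_)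
open import Data.Empty using (⊥; ⊥-elim)
open import Data.List using (List; []; _∷_; _++_; map; length; zip)
open import Data.List.Membership.Propositional using (_∈_)
open import Data.List.Properties using (map-++; map-∘; map-cong; map-id; length-map; length-++)
open import Data.List.Relation.Unary.All using (All; []; _∷_; all?)
open import Data.List.Relation.Unary.Any using (here; there)
open import Data.Nat using (ℕ; zero; suc; _+_; _*_; _^_; _≤_; _<ᵇ_; _≤ᵇ_; z≤n; s≤s; _/_)
open import Data.Nat.Divisibility using (_∣_)
open import Data.Nat.ListAction using (sum)
open import Data.Nat.Properties
open import Data.Nat.Tactic.RingSolver using (solve-∀)
open import Data.Product using (∃; _×_; _,_; proj₁; proj₂)
open import Data.Sum using (inj₁; inj₂)
open import Data.Unit using (⊤; tt)
open import Data.Vec using (Vec; []; _∷_; head; tail; reverse)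
open import Data.Vec.Properties using (≡-dec)
open import Function using (_∘_; id)
open import Function.Bundles using (Equivalence)
open import Relation.Binary.Definitions using (DecidableEquality)
open import Relation.Nullary using (¬_; Dec; yes; no; ¬?)
open import Relation.Nullary.Decidable using (toWitness; map′; _×-dec_; _⊎-dec_)
open import Relation.Binary.PropositionalEquality
  using (_≡_; _≢_; refl; sym; trans; cong; cong₂; subst; module ≡-Reasoning)
open import Algebra.Properties.CommutativeSemigroup +-commutativeSemigroup
  using (interchange; xy∙z≈y∙xz)
open import Algebra.Properties.CommutativeSemigroup
  (CommutativeRing.+-commutativeSemigroup xor-∧-commutativeRing)
  using () renaming (interchange to xor-interchange)

odd : ℕ → Bool
odd zero    = false
odd (suc m) = not (odd m)

odd-+ : ∀ m n → odd (m + n) ≡ odd m xor odd n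
odd-+ zero    n = refl
odd-+ (suc m) n = trans (cong not (odd-+ m n)) (not-distribˡ-xor (odd m) (odd n))

odd-double : ∀ u → odd (2 * u) ≡ false
odd-double u = begin
  odd (u + (u + 0))  ≡⟨ cong (λ x → odd (u + x)) (+-identityʳ u) ⟩
  odd (u + u)        ≡⟨ odd-+ u u ⟩
  odd u xor odd u    ≡⟨ xor-same (odd u) ⟩
  false              ∎
  where open ≡-Reasoning

⟦_⟧ : Bool → ℕ
⟦ b ⟧ = if b then 1 else 0

count : {A : Set} → (A → Bool) → List A → ℕ
count f []       = 0
count f (x ∷ xs) = ⟦ f x ⟧ + count f xs

count-++ : {A : Set} (f : A → Bool) (xs ys : List A) →
           count f (xs ++ ys) ≡ count f xs + count f ys
count-++ f []       ys = refl
count-++ f (x ∷ xs) ys =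
  trans (cong (⟦ f x ⟧ +_) (count-++ f xs ys)) (sym (+-assoc ⟦ f x ⟧ (count f xs) (count f ys)))

count-cong : {A : Set} {f g : A → Bool} (xs : List A) →
             (∀ {x} → x ∈ xs → f x ≡ g x) → count f xs ≡ count g xs
count-cong []       f≗g = refl
count-cong (x ∷ xs) f≗g = cong₂ (λ b c → ⟦ b ⟧ + c) (f≗g (here refl)) (count-cong xs (f≗g ∘ there))

count-complement : ∀ bs → count id bs + count id (map not bs) ≡ length bs
count-complement []           = refl
count-complement (true  ∷ bs) = cong suc (count-complement bs)
count-complement (false ∷ bs) =
  trans (+-suc (count id bs) (count id (map not bs))) (cong suc (count-complement bs))

-- For g₁ … g_k in a structure (A, ∙, ε), the list ε ∷ sums _∙_ ε gs enumerates
-- the 2^k sums Σ cᵢgᵢ with c ∈ 𝔽₂ᵏ; sums itself lists those with c ≠ 0.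
sums : {A : Set} → (A → A → A) → A → List A → List A
sums _∙_ ε []       = []
sums _∙_ ε (g ∷ gs) = sums _∙_ ε gs ++ map (g ∙_) (ε ∷ sums _∙_ ε gs)

sums-length : {A : Set} (_∙_ : A → A → A) (ε : A) (gs : List A) →
              length (ε ∷ sums _∙_ ε gs) ≡ 2 ^ length gs
sums-length _∙_ ε []       = refl
sums-length _∙_ ε (g ∷ gs) = begin
  suc (length (S ++ map (g ∙_) (ε ∷ S)))            ≡⟨ cong suc (length-++ S) ⟩
  suc (length S + length (map (g ∙_) (ε ∷ S)))      ≡⟨ cong (λ l → suc (length S + l)) (length-map (g ∙_) (ε ∷ S)) ⟩
  length (ε ∷ S) + length (ε ∷ S)                   ≡⟨ cong (λ l → l + l) (sums-length _∙_ ε gs) ⟩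
  2 ^ length gs + 2 ^ length gs                     ≡⟨ cong (2 ^ length gs +_) (sym (+-identityʳ _)) ⟩
  2 ^ length (g ∷ gs)                               ∎
  where
  open ≡-Reasoning
  S = sums _∙_ ε gs

sums-hom : {A B : Set} {_∙_ : A → A → A} {ε : A} {_⋆_ : B → B → B} {ε′ : B}
           (f : A → B) → (∀ x y → f (x ∙ y) ≡ f x ⋆ f y) → f ε ≡ ε′ →
           ∀ gs → map f (sums _∙_ ε gs) ≡ sums _⋆_ ε′ (map f gs)
sums-hom f hom f-ε [] = refl
sums-hom {_∙_ = _∙_} {ε} {_⋆_} {ε′} f hom f-ε (g ∷ gs) = begin
  map f (S ++ map (g ∙_) (ε ∷ S))                ≡⟨ map-++ f S _ ⟩
  map f S ++ map f (map (g ∙_) (ε ∷ S))          ≡⟨ cong (map f S ++_) (sym (map-∘ (ε ∷ S))) ⟩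
  map f S ++ map (f ∘ (g ∙_)) (ε ∷ S)            ≡⟨ cong (map f S ++_) (map-cong (hom g) (ε ∷ S)) ⟩
  map f S ++ map ((f g ⋆_) ∘ f) (ε ∷ S)          ≡⟨ cong (map f S ++_) (map-∘ (ε ∷ S)) ⟩
  map f S ++ map (f g ⋆_) (f ε ∷ map f S)        ≡⟨ cong₂ (λ S′ e → S′ ++ map (f g ⋆_) (e ∷ S′))
                                                          (sums-hom f hom f-ε gs) f-ε ⟩
  S′ ++ map (f g ⋆_) (ε′ ∷ S′)                   ∎
  where
  open ≡-Reasoning
  S  = sums _∙_ ε gs
  S′ = sums _⋆_ ε′ (map f gs)

column-count : ∀ bs → 2 * count id (sums _xor_ false bs) ≡ 2 ^ length bs * ⟦ or bs ⟧
column-count [] = refl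
column-count (false ∷ bs) = begin
  2 * count id (S ++ map (false xor_) (false ∷ S))  ≡⟨ cong (λ L → 2 * count id (S ++ L)) (map-id (false ∷ S)) ⟩
  2 * count id (S ++ false ∷ S)                    ≡⟨ cong (2 *_) (count-++ id S (false ∷ S)) ⟩
  2 * (c + c)                                      ≡⟨ *-distribˡ-+ 2 c c ⟩
  2 * c + 2 * c                                    ≡⟨ cong₂ _+_ (column-count bs) (column-count bs) ⟩
  2 ^ l * o + 2 ^ l * o                            ≡⟨ sym (*-distribʳ-+ o (2 ^ l) (2 ^ l)) ⟩
  (2 ^ l + 2 ^ l) * o                              ≡⟨ cong (λ x → (2 ^ l + x) * o) (sym (+-identityʳ (2 ^ l))) ⟩
  2 ^ suc l * o                                    ∎
  where
  open ≡-Reasoning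
  S = sums _xor_ false bs
  c = count id S
  l = length bs
  o = ⟦ or bs ⟧
column-count (true ∷ bs) = begin
  2 * count id (S ++ map not (false ∷ S))                ≡⟨ cong (2 *_) (count-++ id S (map not (false ∷ S))) ⟩
  2 * (count id (false ∷ S) + count id (map not (false ∷ S)))  ≡⟨ cong (2 *_) (count-complement (false ∷ S)) ⟩
  2 * length (false ∷ S)                                 ≡⟨ cong (2 *_) (sums-length _xor_ false bs) ⟩
  2 ^ suc (length bs)                                    ≡⟨ sym (*-identityʳ _) ⟩
  2 ^ suc (length bs) * 1                                ∎
  where
  open ≡-Reasoning
  S = sums _xor_ false bs

span⁺ : ∀ {n} → List (Word n) → List (Word n)
span⁺ {n} = sums _⊕_ (zeroW n)

_≟ᵥ_ : ∀ {k} → DecidableEquality (Vec Bool k)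
_≟ᵥ_ = ≡-dec _≟ᵇ_

open import Data.List.Relation.Binary.Subset.DecPropositional (_≟ᵥ_ {5}) using (_⊆_; _⊆?_)

Independent : ∀ {k} → List (Vec Bool k) → Set
Independent {k} vs = All (_≢ zeroW k) (span⁺ vs)

independent? : ∀ {k} (vs : List (Vec Bool k)) → Dec (Independent vs)
independent? {k} vs = all? (λ x → ¬? (x ≟ᵥ zeroW k)) (span⁺ vs)

⊕-interchange : ∀ {n} (x y z w : Word n) → (x ⊕ y) ⊕ (z ⊕ w) ≡ (x ⊕ z) ⊕ (y ⊕ w)
⊕-interchange []      []      []      []      = refl
⊕-interchange (a ∷ x) (b ∷ y) (c ∷ z) (d ∷ w) =
  cong₂ _∷_ (xor-interchange a b c d) (⊕-interchange x y z w)

·-distrib-xor : ∀ {n} a b (g : Word n) → (a xor b) · g ≡ (a · g) ⊕ (b · g)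
·-distrib-xor a b []      = refl
·-distrib-xor a b (x ∷ g) = cong₂ _∷_ (∧-distribʳ-xor x a b) (·-distrib-xor a b g)

false-· : ∀ {n} (g : Word n) → false · g ≡ zeroW n
false-· []      = refl
false-· (x ∷ g) = cong (false ∷_) (false-· g)

zero-⊕ : ∀ n → zeroW n ⊕ zeroW n ≡ zeroW n
zero-⊕ zero    = refl
zero-⊕ (suc n) = cong (false ∷_) (zero-⊕ n)

lincomb-⊕ : ∀ {n k} (u v : Vec Bool k) (G : Vec (Word n) k) →
            lincomb (u ⊕ v) G ≡ lincomb u G ⊕ lincomb v G
lincomb-⊕ {n} []      []      []      = sym (zero-⊕ n)
lincomb-⊕     (a ∷ u) (b ∷ v) (g ∷ G) =
  trans (cong₂ _⊕_ (·-distrib-xor a b g) (lincomb-⊕ u v G))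
        (⊕-interchange (a · g) (b · g) (lincomb u G) (lincomb v G))

lincomb-zero : ∀ {n k} (G : Vec (Word n) k) → lincomb (zeroW k) G ≡ zeroW n
lincomb-zero {n} []      = refl
lincomb-zero {n} (g ∷ G) = trans (cong₂ _⊕_ (false-· g) (lincomb-zero G)) (zero-⊕ n)

encode-span : ∀ {n k} (G : Vec (Word n) k) (vs : List (Vec Bool k)) →
              map (λ v → lincomb v G) (span⁺ vs) ≡ span⁺ (map (λ v → lincomb v G) vs)
encode-span G = sums-hom (λ v → lincomb v G) (λ u v → lincomb-⊕ u v G) (lincomb-zero G)

totalWeight : ∀ {n} → List (Word n) → ℕ
totalWeight ws = sum (map weight ws)

support : ∀ {n} → List (Word n) → ℕ
support {zero}  gs = 0
support {suc n} gs = ⟦ or (map head gs) ⟧ + support (map tail gs)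

support≤length : ∀ {n} (gs : List (Word n)) → support gs ≤ n
support≤length {zero}  gs = z≤n
support≤length {suc n} gs with or (map head gs)
... | true  = s≤s (support≤length (map tail gs))
... | false = m≤n⇒m≤1+n (support≤length (map tail gs))

weight-∷ : ∀ {n} b (w : Word n) → weight (b ∷ w) ≡ ⟦ b ⟧ + weight w
weight-∷ true  w = refl
weight-∷ false w = refl

totalWeight-columns : ∀ {n} (L : List (Word (suc n))) →
                      totalWeight L ≡ count id (map head L) + totalWeight (map tail L)
totalWeight-columns []            = refl
totalWeight-columns ((b ∷ w) ∷ L) = begin
  weight (b ∷ w) + totalWeight L                                 ≡⟨ cong₂ _+_ (weight-∷ b w) (totalWeight-columns L) ⟩
  (⟦ b ⟧ + weight w) + (count id (map head L) + totalWeight (map tail L))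
                                                                 ≡⟨ interchange ⟦ b ⟧ (weight w) _ _ ⟩
  (⟦ b ⟧ + count id (map head L)) + (weight w + totalWeight (map tail L))  ∎
  where open ≡-Reasoning

totalWeight-empty : (L : List (Word 0)) → totalWeight L ≡ 0
totalWeight-empty []        = refl
totalWeight-empty ([] ∷ L) = totalWeight-empty L

span-weight : ∀ {n} (gs : List (Word n)) → 2 * totalWeight (span⁺ gs) ≡ 2 ^ length gs * support gs
span-weight {zero} gs =
  trans (cong (2 *_) (totalWeight-empty (span⁺ gs))) (sym (*-zeroʳ (2 ^ length gs)))
span-weight {suc n} gs = begin
  2 * totalWeight (span⁺ gs)
    ≡⟨ cong (2 *_) (totalWeight-columns (span⁺ gs)) ⟩
  2 * (count id (map head (span⁺ gs)) + totalWeight (map tail (span⁺ gs)))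
    ≡⟨ cong₂ (λ h t → 2 * (count id h + totalWeight t)) heads tails ⟩
  2 * (count id (sums _xor_ false H) + totalWeight (span⁺ R))
    ≡⟨ *-distribˡ-+ 2 (count id (sums _xor_ false H)) (totalWeight (span⁺ R)) ⟩
  2 * count id (sums _xor_ false H) + 2 * totalWeight (span⁺ R)
    ≡⟨ cong₂ _+_ (column-count H) (span-weight R) ⟩
  2 ^ length H * ⟦ or H ⟧ + 2 ^ length R * support R
    ≡⟨ cong₂ (λ a b → 2 ^ a * ⟦ or H ⟧ + 2 ^ b * support R) (length-map head gs) (length-map tail gs) ⟩
  2 ^ length gs * ⟦ or H ⟧ + 2 ^ length gs * support R
    ≡⟨ sym (*-distribˡ-+ (2 ^ length gs) ⟦ or H ⟧ (support R)) ⟩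
  2 ^ length gs * support gs
    ∎
  where
  open ≡-Reasoning
  H = map head gs
  R = map tail gs
  heads : map head (span⁺ gs) ≡ sums _xor_ false H
  heads = sums-hom head (λ { (a ∷ x) (b ∷ y) → refl }) refl gs
  tails : map tail (span⁺ gs) ≡ span⁺ R
  tails = sums-hom tail (λ { (a ∷ x) (b ∷ y) → refl }) refl gs

-- Messages, i.e. vectors of 𝔽₂⁵; the nonzero ones are the 31 points of PG(4,2).
Msg : Set
Msg = Vec Bool 5

OddOnPlanes : (Msg → Bool) → Set
OddOnPlanes σ = ∀ a b c → Independent (a ∷ b ∷ c ∷ []) → T (odd (count σ (span⁺ (a ∷ b ∷ c ∷ []))))

SparseOnHyperplanes : (Msg → Bool) → Set
SparseOnHyperplanes σ = ∀ a b c d → Independent (a ∷ b ∷ c ∷ d ∷ []) → count σ (span⁺ (a ∷ b ∷ c ∷ d ∷ [])) ≤ 6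

even-lower : ∀ K → 11 ≤ K → K ≢ 12 → 11 + 3 * ⟦ not (odd K) ⟧ ≤ K
even-lower K 11≤K = subst Bound (proj₂ offset) (above-11 (proj₁ offset))
  where
  Bound : ℕ → Set
  Bound K = K ≢ 12 → 11 + 3 * ⟦ not (odd K) ⟧ ≤ K
  offset : ∃ λ j → 11 + j ≡ K
  offset = m≤n⇒∃[o]m+o≡n 11≤K
  at-most-14 : ∀ b → 11 + 3 * ⟦ b ⟧ ≤ 14
  at-most-14 true  = ≤-refl
  at-most-14 false = m≤m+n 11 3
  above-11 : ∀ j → 11 + j ≢ 12 → 11 + 3 * ⟦ not (odd (11 + j)) ⟧ ≤ 11 + j
  above-11 0 _                    = ≤-refl
  above-11 1 11+1≢12              = ⊥-elim (11+1≢12 refl)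
  above-11 2 _                    = m≤m+n 11 2
  above-11 (suc (suc (suc j))) _ = ≤-trans (at-most-14 (not (odd (14 + j)))) (m≤m+n 14 j)

third-bound : ∀ a m r {c} → r ≤ 2 → a + 3 * c ≤ a + 3 * m + r → c ≤ m
third-bound a m r {c} r≤2 bound = ≤-pred (*-cancelˡ-< 3 c (suc m) (begin-strict
  3 * c        ≤⟨ +-cancelˡ-≤ a _ _ (≤-trans bound (≤-reflexive (+-assoc a (3 * m) r))) ⟩
  3 * m + r    <⟨ +-monoʳ-< (3 * m) (s≤s r≤2) ⟩
  3 * m + 3    ≡⟨ +-comm (3 * m) 3 ⟩
  3 + 3 * m    ≡⟨ sym (*-suc 3 m) ⟩
  3 * suc m    ∎))
  where open ≤-Reasoning

-- A code of length n ≤ 46 whose nonzero words have weight 2K with K ≥ 11 and K ≠ 12;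
-- half v is the K of the codeword encoding v, and v is marked when half v is even.
module Marking {n : ℕ} (n≤46 : n ≤ 46) (G : Vec (Word n) 5) (half : Msg → ℕ)
  (weight≡ : ∀ v → weight (lincomb v G) ≡ half v * 2)
  (half≥11 : ∀ v → v ≢ zeroW 5 → 11 ≤ half v)
  (half≢12 : ∀ v → half v ≢ 12) where

  marked : Msg → Bool
  marked v = not (odd (half v))

  encode : Msg → Word n
  encode v = lincomb v G

  halves : List Msg → ℕ
  halves L = sum (map half L)

  totalWeight-halves : ∀ L → totalWeight (map encode L) ≡ halves L * 2
  totalWeight-halves []      = refl
  totalWeight-halves (v ∷ L) =
    trans (cong₂ _+_ (weight≡ v) (totalWeight-halves L)) (sym (*-distribʳ-+ 2 (half v) (halves L)))

  halves-span : ∀ vs → 4 * halves (span⁺ vs) ≡ 2 ^ length vs * support (map encode vs)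
  halves-span vs = begin
    4 * halves (span⁺ vs)                                 ≡⟨ *-assoc 2 2 (halves (span⁺ vs)) ⟩
    2 * (2 * halves (span⁺ vs))                           ≡⟨ cong (2 *_) (*-comm 2 (halves (span⁺ vs))) ⟩
    2 * (halves (span⁺ vs) * 2)                           ≡⟨ cong (2 *_) (sym (totalWeight-halves (span⁺ vs))) ⟩
    2 * totalWeight (map encode (span⁺ vs))               ≡⟨ cong (λ L → 2 * totalWeight L) (encode-span G vs) ⟩
    2 * totalWeight (span⁺ (map encode vs))               ≡⟨ span-weight (map encode vs) ⟩
    2 ^ length (map encode vs) * support (map encode vs)  ≡⟨ cong (λ l → 2 ^ l * support (map encode vs)) (length-map encode vs) ⟩
    2 ^ length vs * support (map encode vs)               ∎
    where open ≡-Reasoning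

  halves-parity : ∀ L → odd (halves L) ≡ odd (length L + count marked L)
  halves-parity []      = refl
  halves-parity (v ∷ L) = begin
    odd (half v + halves L)                            ≡⟨ odd-+ (half v) (halves L) ⟩
    odd (half v) xor odd (halves L)                    ≡⟨ cong (odd (half v) xor_) (halves-parity L) ⟩
    odd (half v) xor odd (length L + count marked L)   ≡⟨ step (odd (half v)) ⟩
    odd (suc (length L) + count marked (v ∷ L))        ∎
    where
    open ≡-Reasoning
    l = length L
    c = count marked L
    step : ∀ b → b xor odd (l + c) ≡ odd (suc l + (⟦ not b ⟧ + c))
    step true  = refl
    step false = sym (trans (cong (not ∘ odd) (+-suc l c)) (not-involutive (odd (l + c))))

  -- Each nonzero message contributes K ≥ 11, and K ≥ 14 when marked.
  halves-lower : ∀ L → All (_≢ zeroW 5) L → 11 * length L + 3 * count marked L ≤ halves L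
  halves-lower []      []            = z≤n
  halves-lower (v ∷ L) (v≢0 ∷ L≢0) = begin
    11 * (1 + length L) + 3 * (⟦ marked v ⟧ + count marked L)      ≡⟨ regroup (length L) ⟦ marked v ⟧ (count marked L) ⟩
    (11 + 3 * ⟦ marked v ⟧) + (11 * length L + 3 * count marked L) ≤⟨ +-mono-≤ (even-lower (half v) (half≥11 v v≢0) (half≢12 v))
                                                                                 (halves-lower L L≢0) ⟩
    half v + halves L                                              ∎
    where
    open ≤-Reasoning
    regroup : ∀ l m c → 11 * (1 + l) + 3 * (m + c) ≡ (11 + 3 * m) + (11 * l + 3 * c)
    regroup = solve-∀

  marked-budget : ∀ vs → Independent vs →
                  4 * (11 * length (span⁺ vs) + 3 * count marked (span⁺ vs)) ≤ 2 ^ length vs * 46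
  marked-budget vs ind = begin
    4 * (11 * length (span⁺ vs) + 3 * count marked (span⁺ vs))  ≤⟨ *-monoʳ-≤ 4 (halves-lower (span⁺ vs) ind) ⟩
    4 * halves (span⁺ vs)                                       ≡⟨ halves-span vs ⟩
    2 ^ length vs * support (map encode vs)                     ≤⟨ *-monoʳ-≤ (2 ^ length vs) (≤-trans (support≤length _) n≤46) ⟩
    2 ^ length vs * 46                                          ∎
    where open ≤-Reasoning

  -- Dimension 3: Σ K = 2·|support| is even, so every plane has an odd number of marked points.
  planes-odd : OddOnPlanes marked
  planes-odd a b c _ = Equivalence.from T-≡ (not-injective not-odd)
    where
    open ≡-Reasoning
    vs = a ∷ b ∷ c ∷ []
    m = count marked (span⁺ vs)
    u = support (map encode vs)
    halves≡ : halves (span⁺ vs) ≡ 2 * u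
    halves≡ = *-cancelˡ-≡ _ (2 * u) 4 (trans (halves-span vs) (*-assoc 4 2 u))
    not-odd : not (odd m) ≡ not true
    not-odd = begin
      not (odd m)              ≡⟨ sym (odd-+ 7 m) ⟩
      odd (7 + m)              ≡⟨ sym (halves-parity (span⁺ vs)) ⟩
      odd (halves (span⁺ vs))  ≡⟨ cong odd halves≡ ⟩
      odd (2 * u)              ≡⟨ odd-double u ⟩
      false                    ∎

  -- Dimension 4: 15·11 + 3·#marked ≤ Σ K ≤ 4·46, so a hyperplane has at most 6 marked points.
  hyperplanes-sparse : SparseOnHyperplanes marked
  hyperplanes-sparse a b c d ind =
    third-bound 165 6 1 (s≤s z≤n) (*-cancelˡ-≤ 4 (marked-budget (a ∷ b ∷ c ∷ d ∷ []) ind))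

  -- Dimension 5: 31·11 + 3·#marked ≤ Σ K ≤ 8·46, so at most 9 points are marked.
  overall-sparse : ∀ a b c d e → Independent (a ∷ b ∷ c ∷ d ∷ e ∷ []) →
                   count marked (span⁺ (a ∷ b ∷ c ∷ d ∷ e ∷ [])) ≤ 9
  overall-sparse a b c d e ind =
    third-bound 341 9 0 z≤n (*-cancelˡ-≤ 4 (marked-budget (a ∷ b ∷ c ∷ d ∷ e ∷ []) ind))

-- The message whose coordinates are the binary digits of m, most significant first.
pt : ℕ → Msg
pt m = reverse (bits 5 m)
  where
  bits : (k : ℕ) → ℕ → Vec Bool k
  bits zero    _ = []
  bits (suc k) m = odd m ∷ bits k (m / 2)

-- The standard basis; span⁺ units lists the 31 points pt 1, pt 2, …, pt 31 in order.
units : List Msg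
units = pt 16 ∷ pt 8 ∷ pt 4 ∷ pt 2 ∷ pt 1 ∷ []

data Constraint : Set where
  plane      : ℕ → ℕ → ℕ → Constraint
  hyperplane : ℕ → ℕ → ℕ → ℕ → Constraint

basis : Constraint → List Msg
basis (plane a b c)        = map pt (a ∷ b ∷ c ∷ [])
basis (hyperplane a b c d) = map pt (a ∷ b ∷ c ∷ d ∷ [])

holdsOn : (Msg → Bool) → Constraint → List Msg → Bool
holdsOn σ (plane _ _ _)        pts = odd (count σ pts)
holdsOn σ (hyperplane _ _ _ _) pts = count σ pts ≤ᵇ 6

holds : (Msg → Bool) → Constraint → Bool
holds σ con = holdsOn σ con (span⁺ (basis con))

holdsOn-cong : ∀ {σ τ} con pts → (∀ {x} → x ∈ pts → σ x ≡ τ x) → holdsOn σ con pts ≡ holdsOn τ con pts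
holdsOn-cong (plane _ _ _)        pts σ≗τ = cong odd (count-cong pts σ≗τ)
holdsOn-cong (hyperplane _ _ _ _) pts σ≗τ = cong (_≤ᵇ 6) (count-cong pts σ≗τ)

-- A constraint together with its points, computed once so that the search does
-- not recompute them at every node.
record Check : Set where
  constructor check
  field
    constraint : Constraint
    points     : List Msg
    points≡    : points ≡ span⁺ (basis constraint)

open Check

compile : Constraint → Check
compile con = check con (span⁺ (basis con)) refl

-- Partial markings, stored as complete binary trees indexed by the coordinates.
data BitMap : ℕ → Set where
  leaf : Bool → BitMap zero
  node : ∀ {k} → BitMap k → BitMap k → BitMap (suc k)

lookup : ∀ {k} → BitMap k → Vec Bool k → Bool
lookup (leaf b)   []          = b
lookup (node l r) (false ∷ v) = lookup l v
lookup (node l r) (true  ∷ v) = lookup r v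

insert : ∀ {k} → BitMap k → Vec Bool k → Bool → BitMap k
insert (leaf _)   []          b = leaf b
insert (node l r) (false ∷ v) b = node (insert l v b) r
insert (node l r) (true  ∷ v) b = node l (insert r v b)

empty : ∀ k → BitMap k
empty zero    = leaf false
empty (suc k) = node (empty k) (empty k)

lookup-insert-same : ∀ {k} (t : BitMap k) v b → lookup (insert t v b) v ≡ b
lookup-insert-same (leaf _)   []          b = refl
lookup-insert-same (node l r) (false ∷ v) b = lookup-insert-same l v b
lookup-insert-same (node l r) (true  ∷ v) b = lookup-insert-same r v b

lookup-insert-other : ∀ {k} (t : BitMap k) v w b → w ≢ v → lookup (insert t v b) w ≡ lookup t w
lookup-insert-other (leaf _)   []          []          b w≢v = ⊥-elim (w≢v refl)
lookup-insert-other (node l r) (false ∷ v) (false ∷ w) b w≢v = lookup-insert-other l v w b (w≢v ∘ cong (false ∷_))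
lookup-insert-other (node l r) (false ∷ v) (true  ∷ w) b w≢v = refl
lookup-insert-other (node l r) (true  ∷ v) (false ∷ w) b w≢v = refl
lookup-insert-other (node l r) (true  ∷ v) (true  ∷ w) b w≢v = lookup-insert-other r v w b (w≢v ∘ cong (true ∷_))

Agrees : ∀ {k} → (Vec Bool k → Bool) → BitMap k → List (Vec Bool k) → Set
Agrees σ t P = ∀ {w} → w ∈ P → σ w ≡ lookup t w

agrees-insert : ∀ {k} σ (t : BitMap k) v {P} → Agrees σ t P → Agrees σ (insert t v (σ v)) (v ∷ P)
agrees-insert σ t v agree (here refl) = sym (lookup-insert-same t v (σ v))
agrees-insert σ t v agree {w} (there w∈P) with w ≟ᵥ v
... | yes refl = sym (lookup-insert-same t v (σ v))
... | no  w≢v  = trans (agree w∈P) (sym (lookup-insert-other t v w (σ v) w≢v))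

-- A schedule assigns the points one at a time, each with the constraints that
-- become decidable at that moment.
Schedule : Set
Schedule = List (Msg × List Check)

Valid : List Msg → Schedule → Set
Valid P []              = ⊤
Valid P ((v , cs) ∷ st) =
  All (λ c → Independent (basis (constraint c)) × points c ⊆ v ∷ P) cs × Valid (v ∷ P) st

valid? : ∀ P st → Dec (Valid P st)
valid? P []              = yes tt
valid? P ((v , cs) ∷ st) =
  all? (λ c → independent? (basis (constraint c)) ×-dec (points c ⊆? v ∷ P)) cs ×-dec valid? (v ∷ P) st

-- Backtracking: refuted st t c holds when no extension of the partial marking t,
-- with c marked points so far, satisfies the schedule with at most 9 marked points.
mutual
  refuted : Schedule → BitMap 5 → ℕ → Bool
  refuted []              t c = false
  refuted ((v , cs) ∷ st) t c = refutedWith st cs v t c false ∧ refutedWith st cs v t c true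

  refutedWith : Schedule → List Check → Msg → BitMap 5 → ℕ → Bool → Bool
  refutedWith st cs v t c b =
    (9 <ᵇ ⟦ b ⟧ + c)
    ∨ (not (all (λ ch → holdsOn (lookup (insert t v b)) (constraint ch) (points ch)) cs)
    ∨ refuted st (insert t v b) (⟦ b ⟧ + c))

choose : ∀ (f : Bool → Bool) b → T (f false ∧ f true) → T (f b)
choose f false both = proj₁ (Equivalence.to T-∧ both)
choose f true  both = proj₂ (Equivalence.to T-∧ both)

not-T : ∀ {b} → T (not b) → T b → ⊥
not-T {false} _ ()

refuted-sound : (σ : Msg → Bool) → (∀ con → Independent (basis con) → T (holds σ con)) →
                ∀ st P t c → Agrees σ t P → c ≡ count σ P → Valid P st →
                count σ P + count σ (map proj₁ st) ≤ 9 → refuted st t c ≡ true → ⊥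
refuted-sound σ sat [] P t c agree c≡ valid budget ()
refuted-sound σ sat ((v , cs) ∷ st) P t c agree refl (cs-valid , st-valid) budget refutation =
  extension-fails (choose (refutedWith st cs v t (count σ P)) (σ v) (Equivalence.from T-≡ refutation))
  where
  t′ = insert t v (σ v)

  agree′ : Agrees σ t′ (v ∷ P)
  agree′ = agrees-insert σ t v agree

  budget′ : count σ (v ∷ P) + count σ (map proj₁ st) ≤ 9
  budget′ = subst (_≤ 9) (sym (xy∙z≈y∙xz ⟦ σ v ⟧ (count σ P) _)) budget

  satisfied : ∀ cs → All (λ c → Independent (basis (constraint c)) × points c ⊆ v ∷ P) cs →
              T (all (λ ch → holdsOn (lookup t′) (constraint ch) (points ch)) cs)
  satisfied []                      []                   = tt
  satisfied (check con _ refl ∷ cs) ((ind , sub) ∷ rest) =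
    Equivalence.from T-∧
      (subst T (holdsOn-cong con (span⁺ (basis con)) (agree′ ∘ sub)) (sat con ind) , satisfied cs rest)

  extension-fails : ¬ T (refutedWith st cs v t (count σ P) (σ v))
  extension-fails e with Equivalence.to T-∨ e
  ... | inj₁ over = ≤⇒≯ (m+n≤o⇒m≤o (count σ (v ∷ P)) budget′) (<ᵇ⇒< 9 (count σ (v ∷ P)) over)
  ... | inj₂ e′ with Equivalence.to T-∨ e′
  ...   | inj₁ violated = not-T violated (satisfied cs cs-valid)
  ...   | inj₂ later    = refuted-sound σ sat st (v ∷ P) t′ _ agree′ refl st-valid budget′ (Equivalence.to T-≡ later)

-- All 155 planes (bases of three points) and 31 hyperplanes (bases of four points)
-- of PG(4,2), points written as binary numbers; the i-th entry lists those whose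
-- largest point is pt i, so that they are checked as soon as pt i is assigned.
constraintTable : List (List Constraint)
constraintTable =
  []
  ∷ []
  ∷ []
  ∷ []
  ∷ []
  ∷ []
  ∷ (plane 1 2 4 ∷ [])
  ∷ []
  ∷ []
  ∷ []
  ∷ (plane 1 2 8 ∷ [])
  ∷ []
  ∷ (plane 1 4 8 ∷ plane 1 6 10 ∷ [])
  ∷ (plane 2 4 8 ∷ plane 2 5 9 ∷ plane 3 4 9 ∷ plane 3 5 8 ∷ [])
  ∷ (plane 1 2 12 ∷ plane 1 4 10 ∷ plane 1 6 8 ∷ plane 2 4 9 ∷ plane 2 5 8 ∷ plane 3 4 8
      ∷ plane 3 5 9 ∷ hyperplane 1 2 4 8 ∷ [])
  ∷ []
  ∷ []
  ∷ []
  ∷ (plane 1 2 16 ∷ [])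
  ∷ []
  ∷ (plane 1 4 16 ∷ plane 1 6 18 ∷ [])
  ∷ (plane 2 4 16 ∷ plane 2 5 17 ∷ plane 3 4 17 ∷ plane 3 5 16 ∷ [])
  ∷ (plane 1 2 20 ∷ plane 1 4 18 ∷ plane 1 6 16 ∷ plane 2 4 17 ∷ plane 2 5 16 ∷ plane 3 4 16
      ∷ plane 3 5 17 ∷ hyperplane 1 2 4 16 ∷ [])
  ∷ []
  ∷ (plane 1 8 16 ∷ plane 1 10 18 ∷ plane 1 12 20 ∷ plane 1 14 22 ∷ [])
  ∷ (plane 2 8 16 ∷ plane 2 9 17 ∷ plane 2 12 20 ∷ plane 2 13 21 ∷ plane 3 8 17 ∷ plane 3 9 16
      ∷ plane 3 12 21 ∷ plane 3 13 20 ∷ [])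
  ∷ (plane 1 2 24 ∷ plane 1 8 18 ∷ plane 1 10 16 ∷ plane 1 12 22 ∷ plane 1 14 20 ∷ plane 2 8 17
      ∷ plane 2 9 16 ∷ plane 2 12 21 ∷ plane 2 13 20 ∷ plane 3 8 16 ∷ plane 3 9 17
      ∷ plane 3 12 20 ∷ plane 3 13 21 ∷ hyperplane 1 2 8 16 ∷ hyperplane 1 2 12 20 ∷ [])
  ∷ (plane 4 8 16 ∷ plane 4 9 17 ∷ plane 4 10 18 ∷ plane 4 11 19 ∷ plane 5 8 17 ∷ plane 5 9 16
      ∷ plane 5 10 19 ∷ plane 5 11 18 ∷ plane 6 8 18 ∷ plane 6 9 19 ∷ plane 6 10 16
      ∷ plane 6 11 17 ∷ plane 7 8 19 ∷ plane 7 9 18 ∷ plane 7 10 17 ∷ plane 7 11 16 ∷ [])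
  ∷ (plane 1 4 24 ∷ plane 1 6 26 ∷ plane 1 8 20 ∷ plane 1 10 22 ∷ plane 1 12 16 ∷ plane 1 14 18
      ∷ plane 4 8 17 ∷ plane 4 9 16 ∷ plane 4 10 19 ∷ plane 4 11 18 ∷ plane 5 8 16
      ∷ plane 5 9 17 ∷ plane 5 10 18 ∷ plane 5 11 19 ∷ plane 6 8 19 ∷ plane 6 9 18
      ∷ plane 6 10 17 ∷ plane 6 11 16 ∷ plane 7 8 18 ∷ plane 7 9 19 ∷ plane 7 10 16
      ∷ plane 7 11 17 ∷ hyperplane 1 4 8 16 ∷ hyperplane 1 4 10 18 ∷ hyperplane 1 6 8 18
      ∷ hyperplane 1 6 10 16 ∷ [])
  ∷ (plane 2 4 24 ∷ plane 2 5 25 ∷ plane 2 8 20 ∷ plane 2 9 21 ∷ plane 2 12 16 ∷ plane 2 13 17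
      ∷ plane 3 4 25 ∷ plane 3 5 24 ∷ plane 3 8 21 ∷ plane 3 9 20 ∷ plane 3 12 17
      ∷ plane 3 13 16 ∷ plane 4 8 18 ∷ plane 4 9 19 ∷ plane 4 10 16 ∷ plane 4 11 17
      ∷ plane 5 8 19 ∷ plane 5 9 18 ∷ plane 5 10 17 ∷ plane 5 11 16 ∷ plane 6 8 16
      ∷ plane 6 9 17 ∷ plane 6 10 18 ∷ plane 6 11 19 ∷ plane 7 8 17 ∷ plane 7 9 16
      ∷ plane 7 10 19 ∷ plane 7 11 18 ∷ hyperplane 2 4 8 16 ∷ hyperplane 2 4 9 17
      ∷ hyperplane 2 5 8 17 ∷ hyperplane 2 5 9 16 ∷ hyperplane 3 4 8 17 ∷ hyperplane 3 4 9 16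
      ∷ hyperplane 3 5 8 16 ∷ hyperplane 3 5 9 17 ∷ [])
  ∷ (plane 1 2 28 ∷ plane 1 4 26 ∷ plane 1 6 24 ∷ plane 1 8 22 ∷ plane 1 10 20 ∷ plane 1 12 18
      ∷ plane 1 14 16 ∷ plane 2 4 25 ∷ plane 2 5 24 ∷ plane 2 8 21 ∷ plane 2 9 20
      ∷ plane 2 12 17 ∷ plane 2 13 16 ∷ plane 3 4 24 ∷ plane 3 5 25 ∷ plane 3 8 20
      ∷ plane 3 9 21 ∷ plane 3 12 16 ∷ plane 3 13 17 ∷ plane 4 8 19 ∷ plane 4 9 18
      ∷ plane 4 10 17 ∷ plane 4 11 16 ∷ plane 5 8 18 ∷ plane 5 9 19 ∷ plane 5 10 16
      ∷ plane 5 11 17 ∷ plane 6 8 17 ∷ plane 6 9 16 ∷ plane 6 10 19 ∷ plane 6 11 18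
      ∷ plane 7 8 16 ∷ plane 7 9 17 ∷ plane 7 10 18 ∷ plane 7 11 19 ∷ hyperplane 1 2 4 24
      ∷ hyperplane 1 2 8 20 ∷ hyperplane 1 2 12 16 ∷ hyperplane 1 4 8 18 ∷ hyperplane 1 4 10 16
      ∷ hyperplane 1 6 8 16 ∷ hyperplane 1 6 10 18 ∷ hyperplane 2 4 8 17 ∷ hyperplane 2 4 9 16
      ∷ hyperplane 2 5 8 16 ∷ hyperplane 2 5 9 17 ∷ hyperplane 3 4 8 16 ∷ hyperplane 3 4 9 17
      ∷ hyperplane 3 5 8 17 ∷ hyperplane 3 5 9 16 ∷ [])
  ∷ []

schedule : Schedule
schedule = zip (span⁺ units) (map (map compile) constraintTable)

schedule-refuted : refuted schedule (empty 5) 0 ≡ true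
schedule-refuted = refl

no-marking : (σ : Msg → Bool) → OddOnPlanes σ → SparseOnHyperplanes σ → count σ (span⁺ units) ≤ 9 → ⊥
no-marking σ odd-planes sparse few =
  refuted-sound σ satisfies schedule [] (empty 5) 0 (λ ()) refl
    (toWitness {a? = valid? [] schedule} tt) few schedule-refuted
  where
  satisfies : ∀ con → Independent (basis con) → T (holds σ con)
  satisfies (plane a b c)        ind = odd-planes (pt a) (pt b) (pt c) ind
  satisfies (hyperplane a b c d) ind = ≤⇒≤ᵇ (sparse (pt a) (pt b) (pt c) (pt d) ind)

∃-cube? : ∀ k {P : Vec Bool k → Set} → (∀ v → Dec (P v)) → Dec (∃ P)
∃-cube? zero    P? = map′ ([] ,_) (λ { ([] , p) → p }) (P? [])
∃-cube? (suc k) {P} P? =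
  map′ (λ { (inj₁ (v , p)) → false ∷ v , p ; (inj₂ (v , p)) → true ∷ v , p })
       (λ { (false ∷ v , p) → inj₁ (v , p) ; (true ∷ v , p) → inj₂ (v , p) })
       (∃-cube? k {λ v → P (false ∷ v)} (λ v → P? (false ∷ v))
          ⊎-dec ∃-cube? k {λ v → P (true ∷ v)} (λ v → P? (true ∷ v)))

weight-24-unavoidable : ∀ {n} → n ≤ 46 → (C : LinearCode n 5) → IsEven C → MinDist C 22 →
                        (∀ v → weight (lincomb v (gen C)) ≢ 24) → ⊥
weight-24-unavoidable {n} n≤46 C even (min-weight , _) no-24 =
  no-marking marked planes-odd hyperplanes-sparse
             (overall-sparse (pt 16) (pt 8) (pt 4) (pt 2) (pt 1) (toWitness {a? = independent? units} tt))
  where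
  encode : Msg → Word n
  encode v = lincomb v (gen C)
  half : Msg → ℕ
  half v = _∣_.quotient (even (encode v) (v , refl))
  weight≡ : ∀ v → weight (encode v) ≡ half v * 2
  weight≡ v = _∣_.equality (even (encode v) (v , refl))
  half≥11 : ∀ v → v ≢ zeroW 5 → 11 ≤ half v
  half≥11 v v≢0 = *-cancelʳ-≤ 11 (half v) 2
    (subst (22 ≤_) (weight≡ v) (min-weight (encode v) (v , refl) (v≢0 ∘ indep C v)))
  half≢12 : ∀ v → half v ≢ 12
  half≢12 v half≡12 = no-24 v (trans (weight≡ v) (cong (_* 2) half≡12))
  open Marking n≤46 (gen C) half weight≡ half≥11 half≢12
    using (marked; planes-odd; hyperplanes-sparse; overall-sparse)

lemma7 : (n : ℕ) → n ≤ 46 → (C : LinearCode n 5) → IsEven C → MinDist C 22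
         → ∃ λ w → w ∈C C × weight w ≡ 24
lemma7 n n≤46 C even min-dist with ∃-cube? 5 (λ v → weight (lincomb v (gen C)) ≟ 24)
... | yes (v , weight-24) = lincomb v (gen C) , (v , refl) , weight-24
... | no  no-weight-24    =
  ⊥-elim (weight-24-unavoidable n≤46 C even min-dist (λ v weight-24 → no-weight-24 (v , weight-24)))
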